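{- For each even integer $t \ge 4$ let $M_t = \{ 0, t-4, t-3, t-2, t-1, t, t+1, t+2, t+3, 2t-1 \}$. Then for each even $t \ge 4$ and each integer $\beta \ge 6$, $M_t$ contains an element whose remainder modulo $\beta$ differs from the remainders modulo $\beta$ of all other elements of $M_t$. -}

module Defs where

open import Data.Nat using (ℕ; _+_; _*_; _∸_)
open import Data.List using (List; _∷_; [])

-- M t = { 0, t-4, t-3, t-2, t-1, t, t+1, t+2, t+3, 2t-1 }, as a list
-- (used for t ≥ 4, so truncated subtraction is exact; repeated values,
-- e.g. 0 = t-4 for t = 4, denote the same set element).
M : ℕ → List ℕ
M t = 0 ∷ (t ∸ 4) ∷ (t ∸ 3) ∷ (t ∸ 2) ∷ (t ∸ 1) ∷ t ∷ (t + 1) ∷ (t + 2) ∷ (t + 3) ∷ (2 * t ∸ 1) ∷ []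

-- The elements t - 4, …, t + 3 form a block of eight consecutive integers. Each of
-- the three middle ones t - 1, t, t + 1 lies within distance 5 < β of every block
-- element, so its residue differs from those of all other block elements. The only
-- other elements are 0 and 2t - 1, and their two residues can rule out at most two
-- of the three middle candidates.
module Submission where

open import Defs
open import Data.Nat using (ℕ; _≤_; _<_; _%_; _/_; _+_; _*_; _∸_; NonZero; s≤s; z≤n; _≟_)
open import Data.Nat.Properties
open import Data.Nat.DivMod using (m≡m%n+[m/n]*n; m<n⇒m%n≡m)
open import Data.Nat.Divisibility using (_∣_; divides; n∣m⇒m%n≡0)
open import Data.Product using (∃; _×_; _,_; map₂; swap)
open import Data.Sum using (_⊎_; inj₁; inj₂)
open import Data.List.Membership.Propositional using (_∈_)
open import Data.List.Relation.Unary.Any using (here; there)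
open import Relation.Binary.Definitions using (DecidableEquality)
open import Relation.Binary.PropositionalEquality
open import Relation.Nullary using (yes; no)

%-≡⇒∣∸ : ∀ m n d .{{_ : NonZero d}} → m % d ≡ n % d → d ∣ n ∸ m
%-≡⇒∣∸ m n d eq = divides (n / d ∸ m / d) (begin
  n ∸ m
    ≡⟨ cong₂ _∸_ (m≡m%n+[m/n]*n n d) (m≡m%n+[m/n]*n m d) ⟩
  (n % d + n / d * d) ∸ (m % d + m / d * d)
    ≡⟨ cong (λ r → (r + n / d * d) ∸ (m % d + m / d * d)) (sym eq) ⟩
  (m % d + n / d * d) ∸ (m % d + m / d * d)
    ≡⟨ [m+n]∸[m+o]≡n∸o (m % d) (n / d * d) (m / d * d) ⟩
  n / d * d ∸ m / d * d
    ≡⟨ sym (*-distribʳ-∸ d (n / d) (m / d)) ⟩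
  (n / d ∸ m / d) * d
    ∎)
  where open ≡-Reasoning

%-injective-≤ : ∀ {m n} d .{{_ : NonZero d}} → m ≤ n → n < d + m → m % d ≡ n % d → m ≡ n
%-injective-≤ {m} {n} d m≤n n<d+m eq = ≤-antisym m≤n (m∸n≡0⇒m≤n n∸m≡0)
  where
  n∸m<d : n ∸ m < d
  n∸m<d = m<n+o⇒m∸n<o n m (subst (n <_) (+-comm d m) n<d+m)

  n∸m≡0 : n ∸ m ≡ 0
  n∸m≡0 = trans (sym (m<n⇒m%n≡m n∸m<d)) (n∣m⇒m%n≡0 (n ∸ m) d (%-≡⇒∣∸ m n d eq))

%-injective-near : ∀ {m n} d .{{_ : NonZero d}} →
  n < d + m → m < d + n → m % d ≡ n % d → m ≡ n
%-injective-near {m} {n} d n<d+m m<d+n eq with ≤-total m n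
... | inj₁ m≤n = %-injective-≤ d m≤n n<d+m eq
... | inj₂ n≤m = sym (%-injective-≤ d n≤m m<d+n (sym eq))

∃-avoiding-one : ∀ {A B : Set} {P : A → Set} {b c : A}
  (_≟ᴮ_ : DecidableEquality B) (f : A → B) (s r : B) →
  P b → P c → f b ≢ s → f c ≢ s → f b ≢ f c → ∃ λ x → P x × f x ≢ s × f x ≢ r
∃-avoiding-one {b = b} {c} _≟ᴮ_ f s r pb pc b≢s c≢s b≢c with f b ≟ᴮ r
... | no b≢r  = b , pb , b≢s , b≢r
... | yes b≡r = c , pc , c≢s , λ c≡r → b≢c (trans b≡r (sym c≡r))

∃-avoiding-two : ∀ {A B : Set} {P : A → Set} {a b c : A}
  (_≟ᴮ_ : DecidableEquality B) (f : A → B) (r₁ r₂ : B) →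
  P a → P b → P c → f a ≢ f b → f a ≢ f c → f b ≢ f c →
  ∃ λ x → P x × f x ≢ r₁ × f x ≢ r₂
∃-avoiding-two {a = a} _≟ᴮ_ f r₁ r₂ pa pb pc a≢b a≢c b≢c with f a ≟ᴮ r₁ | f a ≟ᴮ r₂
... | no a≢r₁ | no a≢r₂ = a , pa , a≢r₁ , a≢r₂
... | yes refl | _      = ∃-avoiding-one _≟ᴮ_ f (f a) r₂ pb pc (≢-sym a≢b) (≢-sym a≢c) b≢c
... | no _    | yes refl =
  map₂ (map₂ swap) (∃-avoiding-one _≟ᴮ_ f (f a) r₁ pb pc (≢-sym a≢b) (≢-sym a≢c) b≢c)

-- t - 4 ≤ w ≤ t + 3 and t - 1 ≤ c ≤ t + 1, stated without truncated subtraction.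
InBlock : ℕ → ℕ → Set
InBlock t w = t ≤ 4 + w × w ≤ 3 + t

InCentre : ℕ → ℕ → Set
InCentre t c = t ≤ 1 + c × c ≤ 1 + t

t∸k∈block : ∀ {t k} → k ≤ 4 → InBlock t (t ∸ k)
t∸k∈block {t} {k} k≤4 =
  ≤-trans (m≤n+m∸n t k) (+-monoˡ-≤ (t ∸ k) k≤4) , ≤-trans (m∸n≤m t k) (m≤n+m t 3)

t+k∈block : ∀ {t k} → k ≤ 3 → InBlock t (t + k)
t+k∈block {t} {k} k≤3 =
  ≤-trans (m≤m+n t k) (m≤n+m (t + k) 4) , ≤-trans (+-monoʳ-≤ t k≤3) (≤-reflexive (+-comm t 3))

block-residues-differ : ∀ {t w c β} .{{_ : NonZero β}} → 6 ≤ β →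
  InBlock t w → InCentre t c → w ≢ c → w % β ≢ c % β
block-residues-differ {t} {w} {c} {β} 6≤β (t≤4+w , w≤3+t) (t≤1+c , c≤1+t) w≢c eq =
  w≢c (%-injective-near β c<β+w w<β+c eq)
  where
  c<β+w : c < β + w
  c<β+w = ≤-trans (s≤s (≤-trans c≤1+t (s≤s t≤4+w))) (+-monoˡ-≤ w 6≤β)

  w<β+c : w < β + c
  w<β+c = ≤-trans (s≤s (≤-trans w≤3+t (+-monoʳ-≤ 3 t≤1+c)))
                  (≤-trans (n≤1+n (5 + c)) (+-monoˡ-≤ c 6≤β))

M-elements : ∀ {t m} → m ∈ M t → m ≡ 0 ⊎ m ≡ 2 * t ∸ 1 ⊎ InBlock t m
M-elements (here refl) = inj₁ refl
M-elements (there (here refl)) = inj₂ (inj₂ (t∸k∈block ≤-refl))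
M-elements (there (there (here refl))) = inj₂ (inj₂ (t∸k∈block (s≤s (s≤s (s≤s z≤n)))))
M-elements (there (there (there (here refl)))) = inj₂ (inj₂ (t∸k∈block (s≤s (s≤s z≤n))))
M-elements (there (there (there (there (here refl))))) = inj₂ (inj₂ (t∸k∈block (s≤s z≤n)))
M-elements (there (there (there (there (there (here refl)))))) = inj₂ (inj₂ (t∸k∈block z≤n))
M-elements (there (there (there (there (there (there (here refl))))))) = inj₂ (inj₂ (t+k∈block (s≤s z≤n)))
M-elements (there (there (there (there (there (there (there (here refl)))))))) = inj₂ (inj₂ (t+k∈block (s≤s (s≤s z≤n))))
M-elements (there (there (there (there (there (there (there (there (here refl))))))))) = inj₂ (inj₂ (t+k∈block ≤-refl))
M-elements (there (there (there (there (there (there (there (there (there (here refl)))))))))) = inj₂ (inj₁ refl)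

t∸1-central : ∀ t → InCentre t (t ∸ 1)
t∸1-central t = m≤n+m∸n t 1 , ≤-trans (m∸n≤m t 1) (n≤1+n t)

t-central : ∀ t → InCentre t t
t-central t = n≤1+n t , n≤1+n t

t+1-central : ∀ t → InCentre t (t + 1)
t+1-central t = ≤-trans (m≤m+n t 1) (n≤1+n (t + 1)) , ≤-reflexive (+-comm t 1)

lemma5p2 : ∀ (t β : ℕ) → (∃ λ k → t ≡ 2 * k) → 4 ≤ t → 6 ≤ β → .{{_ : NonZero β}} →
    ∃ λ m → m ∈ M t × (∀ m′ → m′ ∈ M t → m′ ≢ m → m′ % β ≢ m % β)
lemma5p2 t β _ 4≤t 6≤β
  with ∃-avoiding-two {P = λ c → c ∈ M t × InCentre t c} _≟_ (_% β) (0 % β) ((2 * t ∸ 1) % β)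
         (there (there (there (there (here refl)))) , t∸1-central t)
         (there (there (there (there (there (here refl))))) , t-central t)
         (there (there (there (there (there (there (here refl)))))) , t+1-central t)
         (block-residues-differ 6≤β (t∸k∈block (s≤s z≤n)) (t-central t) (<⇒≢ t∸1<t))
         (block-residues-differ 6≤β (t∸k∈block (s≤s z≤n)) (t+1-central t)
           (<⇒≢ (<-trans t∸1<t t<t+1)))
         (block-residues-differ 6≤β (t∸k∈block z≤n) (t+1-central t) (<⇒≢ t<t+1))
  where
  t∸1<t : t ∸ 1 < t
  t∸1<t = ∸-monoʳ-< (s≤s z≤n) (≤-trans (s≤s z≤n) 4≤t)

  t<t+1 : t < t + 1
  t<t+1 = m<m+n t (s≤s z≤n)
... | c , (c∈M , c-central) , c≢0 , c≢2t-1 = c , c∈M , unique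
  where
  unique : ∀ m → m ∈ M t → m ≢ c → m % β ≢ c % β
  unique m m∈M m≢c with M-elements m∈M
  ... | inj₁ refl        = λ eq → c≢0 (sym eq)
  ... | inj₂ (inj₁ refl) = λ eq → c≢2t-1 (sym eq)
  ... | inj₂ (inj₂ m∈B)  = block-residues-differ 6≤β m∈B c-central m≢c
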